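{- Let $N\ge 3$ be an integer and let $B_N$ be the sequence defined by $B_N(n)=n$ for $1\le n\le N$ and, for $n>N$, \[B_N(n)=B_N\bigl(n-B_N(n-1)\bigr)+B_N\bigl(n-B_N(n-2)\bigr)+B_N\bigl(n-B_N(n-3)\bigr),\] where $B_N(n)$ is defined only if $B_N(1),\dots,B_N(n-1)$ are defined and each of the three indices $n-B_N(n-i)$ ($i=1,2,3$) lies in $\{1,2,\dots,n-1\}$. If $N=3$, $N=4$, or $N\ge 10$, then $B_N$ dies (i.e., is a finite sequence). Furthermore, if $N\ge 14$, then $B_N$ has exactly $N+24$ terms.
   Context: A sequence generated this way "dies" if some term $B_N(n)$ is undefined (because a required index $n-B_N(n-i)$ is $\le 0$ or $\ge n$); it then has exactly $m$ terms when $B_N(1),\dots,B_N(m)$ are defined and $B_N(m+1)$ is undefined. -}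

module Defs where

open import Data.Nat using (ℕ; zero; suc; _+_; _∸_; _≤_; _≤?_)
open import Data.List using (List; []; _∷_; length; _++_; [_])
open import Data.Maybe using (Maybe; just; nothing; _>>=_)
open import Relation.Nullary using (yes; no; ¬_)
open import Data.Maybe using (Is-just)
open import Data.Product using (∃-syntax; _×_)

-- 1-indexed lookup: at xs k = just (k-th element) if 1 ≤ k ≤ length xs,
-- nothing otherwise.
at : List ℕ → ℕ → Maybe ℕ
at []       _             = nothing
at (x ∷ xs) zero          = nothing
at (x ∷ xs) (suc zero)    = just x
at (x ∷ xs) (suc (suc k)) = at xs (suc k)

-- Given xs = [B(1), …, B(n)], the i-th summand B(n+1 - B(n+1-i)) for the
-- term of index n+1.  The index (n+1) - b lies in {1,…,n} iff 1 ≤ b ≤ n;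
-- we check this explicitly (truncated subtraction is never used outside
-- that range).
summand : List ℕ → ℕ → Maybe ℕ
summand xs i =
  at xs (suc (length xs) ∸ i) >>= λ b →
  check b
  where
  check : ℕ → Maybe ℕ
  check zero = nothing
  check (suc b') with suc b' ≤? length xs
  ... | yes _ = at xs (suc (length xs) ∸ suc b')
  ... | no  _ = nothing

next : ℕ → List ℕ → Maybe ℕ
next N xs with suc (length xs) ≤? N
... | yes _ = just (suc (length xs))
... | no  _ =
  summand xs 1 >>= λ a →
  summand xs 2 >>= λ b →
  summand xs 3 >>= λ c →
  just (a + b + c)

prefix : ℕ → ℕ → Maybe (List ℕ)
prefix N zero    = just []
prefix N (suc n) = prefix N n >>= λ xs → next N xs >>= λ v → just (xs ++ [ v ])

Defined : ℕ → ℕ → Set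
Defined N n = Is-just (prefix N n)

Dies : ℕ → Set
Dies N = ∃[ n ] ¬ Defined N n

HasExactlyTerms : ℕ → ℕ → Set
HasExactlyTerms N m = Defined N m × ¬ Defined N (suc m)

module Submission where

-- For N = 3, 4, 10, …, 13 the claims are finite computations.  For N = 14 + m
-- every term B(n) with n ≤ N + 24 is an affine function a + b·m of m, with a
-- and b independent of m, and so is every index n − B(n − i).  Hence the
-- recursion can be run once on the coefficient pairs (a , b), deciding each
-- index comparison for all m simultaneously.  This gives B(N + 24) = 39 + 2m,
-- which exceeds N + 24 = 38 + m, so the index (N + 25) − B(N + 24) is not
-- positive.

open import Defs
open import Data.Nat using (ℕ; _≤_; _+_)
open import Data.Sum using (_⊎_)
open import Data.Product using (_×_)
open import Relation.Binary.PropositionalEquality using (_≡_)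

open import Function using (_∘_)
open import Data.Nat using (zero; suc; _∸_; _*_; _<_; _≤?_; _<?_; z≤n; s≤s)
open import Data.Nat.Properties
open import Data.Nat.Tactic.RingSolver using (solve-∀)
open import Data.List using (List; []; _∷_; [_]; _++_; length; map; applyUpTo)
open import Data.List.Properties
  using (length-++; length-map; length-applyUpTo; applyUpTo-∷ʳ; map-++; ++-assoc; ++-identityʳ)
open import Data.Maybe using (Maybe; just; nothing; _>>=_; Is-just)
open import Data.Maybe.Relation.Unary.Any using (just)
open import Data.Product using (_,_; ∃-syntax)
open import Data.Sum using (inj₁; inj₂)
open import Data.Unit using (tt)
open import Relation.Nullary using (¬_; Dec; yes; no; contradiction)
open import Relation.Nullary.Decidable using (_×-dec_)
open import Relation.Binary.PropositionalEquality
  using (refl; sym; trans; cong; cong₂; subst; module ≡-Reasoning)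

>>=-just : ∀ {A B : Set} (mx : Maybe A) {f : A → Maybe B} {y : B} →
           (mx >>= f) ≡ just y → ∃[ x ] mx ≡ just x × f x ≡ just y
>>=-just (just x) eq = x , refl , eq

≡just⇒Is-just : ∀ {A : Set} {mx : Maybe A} {x : A} → mx ≡ just x → Is-just mx
≡just⇒Is-just refl = just tt

≡nothing⇒¬Is-just : ∀ {A : Set} {mx : Maybe A} → mx ≡ nothing → ¬ Is-just mx
≡nothing⇒¬Is-just refl ()

at-applyUpTo-++ : ∀ (f : ℕ → ℕ) n ys {k} → k < n →
                  at (applyUpTo f n ++ ys) (suc k) ≡ just (f k)
at-applyUpTo-++ f (suc n) ys {zero}  _         = refl
at-applyUpTo-++ f (suc n) ys {suc k} (s≤s k<n) = at-applyUpTo-++ (f ∘ suc) n ys k<n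

at-initial : ∀ n ys {k} → 1 ≤ k → k ≤ n → at (applyUpTo suc n ++ ys) k ≡ just k
at-initial n ys {suc k} _ k<n = at-applyUpTo-++ suc n ys k<n

at-++-length : ∀ xs ys t → at (xs ++ ys) (suc (length xs + t)) ≡ at ys (suc t)
at-++-length []       ys t = refl
at-++-length (x ∷ xs) ys t = at-++-length xs ys t

next-initial : ∀ N xs {n} → length xs ≡ n → n < N → next N xs ≡ just (suc n)
next-initial N xs refl len<N with suc (length xs) ≤? N
... | yes _     = refl
... | no  len≮N = contradiction len<N len≮N

next-≡-just : ∀ N xs {a b c} → N ≤ length xs →
              summand xs 1 ≡ just a → summand xs 2 ≡ just b → summand xs 3 ≡ just c →
              next N xs ≡ just (a + b + c)
next-≡-just N xs N≤len eq₁ eq₂ eq₃ with suc (length xs) ≤? N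
... | yes len<N = contradiction N≤len (<⇒≱ len<N)
... | no  _ rewrite eq₁ | eq₂ | eq₃ = refl

next-≡-nothing : ∀ N xs → N ≤ length xs → summand xs 1 ≡ nothing → next N xs ≡ nothing
next-≡-nothing N xs N≤len eq₁ with suc (length xs) ≤? N
... | yes len<N = contradiction N≤len (<⇒≱ len<N)
... | no  _ rewrite eq₁ = refl

summand-≡-just : ∀ xs i {b v} → at xs (suc (length xs) ∸ i) ≡ just b →
                 1 ≤ b → b ≤ length xs → at xs (suc (length xs) ∸ b) ≡ just v →
                 summand xs i ≡ just v
summand-≡-just xs i {suc b} lag _ b≤len val rewrite lag with suc b ≤? length xs
... | yes _     = val
... | no  b≰len = contradiction b≤len b≰len

summand-≡-nothing : ∀ xs i {b} → at xs (suc (length xs) ∸ i) ≡ just b → length xs < b →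
                    summand xs i ≡ nothing
summand-≡-nothing xs i {suc b} lag len<b rewrite lag with suc b ≤? length xs
... | yes b≤len = contradiction b≤len (<⇒≱ len<b)
... | no  _     = refl

prefix-suc-just : ∀ N n {xs v} → prefix N n ≡ just xs → next N xs ≡ just v →
                  prefix N (suc n) ≡ just (xs ++ [ v ])
prefix-suc-just N n eq eq′ rewrite eq | eq′ = refl

prefix-suc-nothing : ∀ N n {xs} → prefix N n ≡ just xs → next N xs ≡ nothing →
                     prefix N (suc n) ≡ nothing
prefix-suc-nothing N n eq eq′ rewrite eq | eq′ = refl

prefix-initial : ∀ N n → n ≤ N → prefix N n ≡ just (applyUpTo suc n)
prefix-initial N zero    _   = refl
prefix-initial N (suc n) n<N =
  trans (prefix-suc-just N n (prefix-initial N n (<⇒≤ n<N))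
                         (next-initial N (applyUpTo suc n) (length-applyUpTo suc n) n<N))
        (cong just (applyUpTo-∷ʳ suc n))

record Affine : Set where
  constructor ⟨_,_⟩
  field
    const slope : ℕ

open Affine

eval : ℕ → Affine → ℕ
eval m ⟨ a , b ⟩ = b * m + a

infixl 6 _+ₐ_
infix 4 _≤ₐ_ _<ₐ_ _≤ₐ?_

_+ₐ_ : Affine → Affine → Affine
⟨ a , b ⟩ +ₐ ⟨ c , d ⟩ = ⟨ a + c , b + d ⟩

_≤ₐ_ : Affine → Affine → Set
p ≤ₐ q = const p ≤ const q × slope p ≤ slope q

_<ₐ_ : Affine → Affine → Set
p <ₐ q = const p < const q × slope p ≤ slope q

_≤ₐ?_ : ∀ p q → Dec (p ≤ₐ q)
p ≤ₐ? q = const p ≤? const q ×-dec slope p ≤? slope q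

InRangeₐ : Affine → Affine → Set
InRangeₐ n p = ⟨ 1 , 0 ⟩ ≤ₐ p × p ≤ₐ n

inRangeₐ? : ∀ n p → Dec (InRangeₐ n p)
inRangeₐ? n p = ⟨ 1 , 0 ⟩ ≤ₐ? p ×-dec p ≤ₐ? n

_∸ₐ_ : Affine → Affine → Maybe Affine
p ∸ₐ q with q ≤ₐ? p
... | yes _ = just ⟨ const p ∸ const q , slope p ∸ slope q ⟩
... | no  _ = nothing

eval-+ : ∀ m p q → eval m (p +ₐ q) ≡ eval m p + eval m q
eval-+ m ⟨ a , b ⟩ ⟨ c , d ⟩ = lemma a b c d m
  where
  lemma : ∀ a b c d m → (b + d) * m + (a + c) ≡ b * m + a + (d * m + c)
  lemma = solve-∀

eval-slope-1 : ∀ m a → eval m ⟨ a , 1 ⟩ ≡ m + a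
eval-slope-1 m a = cong (_+ a) (*-identityˡ m)

eval-mono-≤ : ∀ m {p q} → p ≤ₐ q → eval m p ≤ eval m q
eval-mono-≤ m (a≤c , b≤d) = +-mono-≤ (*-monoˡ-≤ m b≤d) a≤c

eval-mono-< : ∀ m {p q} → p <ₐ q → eval m p < eval m q
eval-mono-< m (a<c , b≤d) = +-mono-≤-< (*-monoˡ-≤ m b≤d) a<c

eval-∸ : ∀ m p q {r} → p ∸ₐ q ≡ just r → eval m p ∸ eval m q ≡ eval m r
eval-∸ m p@(⟨ a , b ⟩) q@(⟨ c , d ⟩) eq with q ≤ₐ? p
eval-∸ m p@(⟨ a , b ⟩) q@(⟨ c , d ⟩) refl | yes (c≤a , d≤b) = begin
  eval m p ∸ eval m q              ≡⟨ cong (λ x → eval m x ∸ eval m q) q+r≡p ⟨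
  eval m (q +ₐ r) ∸ eval m q       ≡⟨ cong (_∸ eval m q) (eval-+ m q r) ⟩
  eval m q + eval m r ∸ eval m q   ≡⟨ m+n∸m≡n (eval m q) (eval m r) ⟩
  eval m r                         ∎
  where
  open ≡-Reasoning
  r : Affine
  r = ⟨ a ∸ c , b ∸ d ⟩
  q+r≡p : q +ₐ r ≡ p
  q+r≡p = cong₂ ⟨_,_⟩ (m+[n∸m]≡n c≤a) (m+[n∸m]≡n d≤b)

atₐ : List Affine → ℕ → Maybe Affine
atₐ []       _             = nothing
atₐ (x ∷ xs) zero          = nothing
atₐ (x ∷ xs) (suc zero)    = just x
atₐ (x ∷ xs) (suc (suc k)) = atₐ xs (suc k)

at-map : ∀ m T k {v} → atₐ T k ≡ just v → at (map (eval m) T) k ≡ just (eval m v)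
at-map m (x ∷ T) (suc zero)    refl = refl
at-map m (x ∷ T) (suc (suc k)) eq   = at-map m T (suc k) eq

-- The recursion of B_{n₀ + m} for an unknown m: T lists the terms after the
-- initial segment B(p) = p, p ≤ n₀ + m.  A comparison that the coefficientwise
-- order does not settle for all m yields nothing.
module Symbolic (n₀ : ℕ) where

  sizeₐ : List Affine → Affine
  sizeₐ T = ⟨ n₀ + length T , 1 ⟩

  topₐ : List Affine → Affine
  topₐ T = ⟨ suc (n₀ + length T) , 1 ⟩

  tailₐ : List Affine → Affine → Maybe Affine
  tailₐ T ⟨ a , 1 ⟩ with n₀ <? a
  ... | yes _ = atₐ T (suc (a ∸ suc n₀))
  ... | no  _ = nothing
  tailₐ T _ = nothing

  lookupₐ : List Affine → Affine → Maybe Affine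
  lookupₐ T p with inRangeₐ? ⟨ n₀ , 1 ⟩ p
  ... | yes _ = just p
  ... | no  _ = tailₐ T p

  backₐ : List Affine → Affine → Maybe Affine
  backₐ T b with inRangeₐ? (sizeₐ T) b
  ... | yes _ = topₐ T ∸ₐ b >>= lookupₐ T
  ... | no  _ = nothing

  summandₐ : List Affine → ℕ → Maybe Affine
  summandₐ T i = backₐ T ⟨ i , 0 ⟩ >>= backₐ T

  nextₐ : List Affine → Maybe Affine
  nextₐ T =
    summandₐ T 1 >>= λ a → summandₐ T 2 >>= λ b → summandₐ T 3 >>= λ c → just (a +ₐ b +ₐ c)

  runₐ : ℕ → Maybe (List Affine)
  runₐ zero    = just []
  runₐ (suc k) = runₐ k >>= λ T → nextₐ T >>= λ v → just (T ++ [ v ])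

module Soundness (n₀ m : ℕ) where
  open Symbolic n₀
  open ≡-Reasoning

  initial : List ℕ
  initial = applyUpTo suc (n₀ + m)

  terms : List Affine → List ℕ
  terms T = initial ++ map (eval m) T

  length-terms : ∀ T → length (terms T) ≡ n₀ + m + length T
  length-terms T = begin
    length (terms T)                           ≡⟨ length-++ initial ⟩
    length initial + length (map (eval m) T)   ≡⟨ cong₂ _+_ (length-applyUpTo suc (n₀ + m))
                                                            (length-map (eval m) T) ⟩
    n₀ + m + length T                          ∎

  n₀+m≤length : ∀ T → n₀ + m ≤ length (terms T)
  n₀+m≤length T = subst (n₀ + m ≤_) (sym (length-terms T)) (m≤m+n (n₀ + m) (length T))

  eval-size : ∀ T → eval m (sizeₐ T) ≡ length (terms T)
  eval-size T = begin
    eval m (sizeₐ T)       ≡⟨ eval-slope-1 m (n₀ + length T) ⟩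
    m + (n₀ + length T)    ≡⟨ shuffle m n₀ (length T) ⟩
    n₀ + m + length T      ≡⟨ length-terms T ⟨
    length (terms T)       ∎
    where
    shuffle : ∀ m n j → m + (n + j) ≡ n + m + j
    shuffle = solve-∀

  eval-top : ∀ T → eval m (topₐ T) ≡ suc (length (terms T))
  eval-top T = trans (+-suc (1 * m) (n₀ + length T)) (cong suc (eval-size T))

  initial-sound : ∀ T p → InRangeₐ ⟨ n₀ , 1 ⟩ p → at (terms T) (eval m p) ≡ just (eval m p)
  initial-sound T p (1≤p , p≤n₀) =
    at-initial (n₀ + m) (map (eval m) T) (eval-mono-≤ m 1≤p) p≤n₀+m
    where
    p≤n₀+m : eval m p ≤ n₀ + m
    p≤n₀+m = subst (eval m p ≤_) (trans (eval-slope-1 m n₀) (+-comm m n₀)) (eval-mono-≤ m p≤n₀)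

  tail-position : ∀ {a} → n₀ < a → eval m ⟨ a , 1 ⟩ ≡ suc (length initial + (a ∸ suc n₀))
  tail-position {a} n₀<a = begin
    eval m ⟨ a , 1 ⟩                     ≡⟨ eval-slope-1 m a ⟩
    m + a                                ≡⟨ cong (m +_) (m+[n∸m]≡n n₀<a) ⟨
    m + (suc n₀ + (a ∸ suc n₀))          ≡⟨ shuffle m n₀ (a ∸ suc n₀) ⟩
    suc (n₀ + m + (a ∸ suc n₀))          ≡⟨ cong (λ l → suc (l + (a ∸ suc n₀)))
                                                 (length-applyUpTo suc (n₀ + m)) ⟨
    suc (length initial + (a ∸ suc n₀))  ∎
    where
    shuffle : ∀ m n t → m + (suc n + t) ≡ suc (n + m + t)
    shuffle = solve-∀

  tail-sound : ∀ T p {v} → tailₐ T p ≡ just v → at (terms T) (eval m p) ≡ just (eval m v)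
  tail-sound T ⟨ a , 1 ⟩ {v} eq with n₀ <? a
  ... | yes n₀<a = begin
    at (terms T) (eval m ⟨ a , 1 ⟩)
      ≡⟨ cong (at (terms T)) (tail-position n₀<a) ⟩
    at (terms T) (suc (length initial + (a ∸ suc n₀)))
      ≡⟨ at-++-length initial (map (eval m) T) (a ∸ suc n₀) ⟩
    at (map (eval m) T) (suc (a ∸ suc n₀))
      ≡⟨ at-map m T (suc (a ∸ suc n₀)) eq ⟩
    just (eval m v)
      ∎

  lookup-sound : ∀ T p {v} → lookupₐ T p ≡ just v → at (terms T) (eval m p) ≡ just (eval m v)
  lookup-sound T p eq with inRangeₐ? ⟨ n₀ , 1 ⟩ p
  lookup-sound T p refl | yes p∈initial = initial-sound T p p∈initial
  lookup-sound T p eq   | no  _         = tail-sound T p eq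

  back-sound : ∀ T b {v} → backₐ T b ≡ just v →
               1 ≤ eval m b × eval m b ≤ length (terms T) ×
               at (terms T) (suc (length (terms T)) ∸ eval m b) ≡ just (eval m v)
  back-sound T b {v} eq with inRangeₐ? (sizeₐ T) b
  ... | yes (1≤b , b≤size) with >>=-just (topₐ T ∸ₐ b) eq
  ...   | p , top∸b≡p , lookup≡v =
    eval-mono-≤ m 1≤b ,
    subst (eval m b ≤_) (eval-size T) (eval-mono-≤ m b≤size) ,
    (begin
      at (terms T) (suc (length (terms T)) ∸ eval m b)
        ≡⟨ cong (λ x → at (terms T) (x ∸ eval m b)) (eval-top T) ⟨
      at (terms T) (eval m (topₐ T) ∸ eval m b)
        ≡⟨ cong (at (terms T)) (eval-∸ m (topₐ T) b top∸b≡p) ⟩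
      at (terms T) (eval m p)
        ≡⟨ lookup-sound T p lookup≡v ⟩
      just (eval m v)
        ∎)

  summand-sound : ∀ T i {v} → summandₐ T i ≡ just v → summand (terms T) i ≡ just (eval m v)
  summand-sound T i eq with >>=-just (backₐ T ⟨ i , 0 ⟩) eq
  ... | b , lag≡b , back≡v with back-sound T ⟨ i , 0 ⟩ lag≡b | back-sound T b back≡v
  ... | _ , _ , lag | 1≤b , b≤length , val = summand-≡-just (terms T) i lag 1≤b b≤length val

  next-sound : ∀ T {v} → nextₐ T ≡ just v → next (n₀ + m) (terms T) ≡ just (eval m v)
  next-sound T eq with >>=-just (summandₐ T 1) eq
  ... | a , eq₁ , eq′ with >>=-just (summandₐ T 2) eq′
  ... | b , eq₂ , eq″ with >>=-just (summandₐ T 3) eq″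
  ... | c , eq₃ , refl = trans
    (next-≡-just (n₀ + m) (terms T) (n₀+m≤length T)
                 (summand-sound T 1 eq₁) (summand-sound T 2 eq₂) (summand-sound T 3 eq₃))
    (cong just (sym (trans (eval-+ m (a +ₐ b) c) (cong (_+ eval m c) (eval-+ m a b)))))

  terms-∷ʳ : ∀ T v → terms T ++ [ eval m v ] ≡ terms (T ++ [ v ])
  terms-∷ʳ T v = trans (++-assoc initial (map (eval m) T) [ eval m v ])
                       (cong (initial ++_) (sym (map-++ (eval m) T [ v ])))

  run-sound : ∀ k {T} → runₐ k ≡ just T → prefix (n₀ + m) (k + (n₀ + m)) ≡ just (terms T)
  run-sound zero refl =
    trans (prefix-initial (n₀ + m) (n₀ + m) ≤-refl) (cong just (sym (++-identityʳ initial)))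
  run-sound (suc k) eq with >>=-just (runₐ k) eq
  ... | T , run≡T , eq′ with >>=-just (nextₐ T) eq′
  ... | v , next≡v , refl =
    trans (prefix-suc-just (n₀ + m) (k + (n₀ + m)) (run-sound k run≡T) (next-sound T next≡v))
          (cong just (terms-∷ʳ T v))

  run-dies : ∀ k {T b} → runₐ k ≡ just T → backₐ T ⟨ 1 , 0 ⟩ ≡ just b → sizeₐ T <ₐ b →
             prefix (n₀ + m) (suc k + (n₀ + m)) ≡ nothing
  run-dies k {T} {b} run≡T lag≡b size<b with back-sound T ⟨ 1 , 0 ⟩ lag≡b
  ... | _ , _ , lag =
    prefix-suc-nothing (n₀ + m) (k + (n₀ + m)) (run-sound k run≡T)
      (next-≡-nothing (n₀ + m) (terms T) (n₀+m≤length T)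
        (summand-≡-nothing (terms T) 1 lag
          (subst (_< eval m b) (eval-size T) (eval-mono-< m size<b))))

hasExactlyTerms-14+ : ∀ m → HasExactlyTerms (14 + m) (14 + m + 24)
hasExactlyTerms-14+ m =
  subst (Defined N) (+-comm 24 N) (≡just⇒Is-just (run-sound 24 refl)) ,
  subst (¬_ ∘ Defined N) (cong suc (+-comm 24 N))
    -- sizeₐ T = ⟨ 38 , 1 ⟩ is N + 24, and B(N + 24) = ⟨ 39 , 2 ⟩
    (≡nothing⇒¬Is-just (run-dies 24 refl refl (≤-refl , s≤s z≤n)))
  where
  open Soundness 14 m
  N = 14 + m

hasExactlyTerms-≥14 : ∀ {N} → 14 ≤ N → HasExactlyTerms N (N + 24)
hasExactlyTerms-≥14 {N} 14≤N =
  subst (λ N → HasExactlyTerms N (N + 24)) (m+[n∸m]≡n 14≤N) (hasExactlyTerms-14+ (N ∸ 14))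

hasExactlyTerms-3 : HasExactlyTerms 3 4
hasExactlyTerms-3 = just tt , λ ()

hasExactlyTerms-4 : HasExactlyTerms 4 5
hasExactlyTerms-4 = just tt , λ ()

hasExactlyTerms-10 : HasExactlyTerms 10 1015
hasExactlyTerms-10 = just tt , λ ()

hasExactlyTerms-11 : HasExactlyTerms 11 117
hasExactlyTerms-11 = just tt , λ ()

hasExactlyTerms-12 : HasExactlyTerms 12 45
hasExactlyTerms-12 = just tt , λ ()

hasExactlyTerms-13 : HasExactlyTerms 13 73
hasExactlyTerms-13 = just tt , λ ()

hasExactlyTerms⇒dies : ∀ N n → HasExactlyTerms N n → Dies N
hasExactlyTerms⇒dies N n (_ , undefined) = suc n , undefined

dies-10+ : ∀ k → k < 4 → Dies (10 + k)
dies-10+ 0 _ = hasExactlyTerms⇒dies 10 1015 hasExactlyTerms-10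
dies-10+ 1 _ = hasExactlyTerms⇒dies 11 117 hasExactlyTerms-11
dies-10+ 2 _ = hasExactlyTerms⇒dies 12 45 hasExactlyTerms-12
dies-10+ 3 _ = hasExactlyTerms⇒dies 13 73 hasExactlyTerms-13
dies-10+ (suc (suc (suc (suc k)))) (s≤s (s≤s (s≤s (s≤s ()))))

dies-≥10 : ∀ {N} → 10 ≤ N → Dies N
dies-≥10 {N} 10≤N with 14 ≤? N
... | yes 14≤N = hasExactlyTerms⇒dies N (N + 24) (hasExactlyTerms-≥14 14≤N)
... | no  14≰N =
  subst Dies (m+[n∸m]≡n 10≤N) (dies-10+ (N ∸ 10) (∸-monoˡ-< (≰⇒> 14≰N) 10≤N))

theorem1 : (N : ℕ) → 3 ≤ N →
    ((N ≡ 3 ⊎ N ≡ 4 ⊎ 10 ≤ N) → Dies N) ×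
    (14 ≤ N → HasExactlyTerms N (N + 24))
theorem1 N _ = dies , hasExactlyTerms-≥14
  where
  dies : (N ≡ 3 ⊎ N ≡ 4 ⊎ 10 ≤ N) → Dies N
  dies (inj₁ refl)         = hasExactlyTerms⇒dies 3 4 hasExactlyTerms-3
  dies (inj₂ (inj₁ refl))  = hasExactlyTerms⇒dies 4 5 hasExactlyTerms-4
  dies (inj₂ (inj₂ 10≤N))  = dies-≥10 10≤N
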